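{- $\|\mathsf{BSML}^{\sqcup}\|=\mathbb{B}=\{\mathcal{P}\mid \mathcal{P}\text{ is invariant under bounded bisimulation}\}$.
   Context: Fix a countably infinite set $\mathsf{Prop}$ of propositional variables. Formulas of $\mathsf{BSML}$ are generated by $\phi ::= p \mid \neg\phi \mid (\phi\wedge\phi) \mid (\phi\vee\phi) \mid \Diamond\phi \mid \mathrm{NE}$ ($p\in\mathsf{Prop}$); $\mathsf{BSML}^{\sqcup}$ extends this grammar with the global disjunction $\phi\sqcup\phi$. A Kripke model over $\mathsf{X}\subseteq\mathsf{Prop}$ is $M=(W,R,V)$ with $W\neq\emptyset$, $R\subseteq W\times W$, $V:\mathsf{X}\to\wp(W)$; a state is any $s\subseteq W$, and $R[w]=\{v\mid wRv\}$. Support $M,s\vDash\phi$ and anti-support $M,s\mathrel{=\!\!\mid}\phi$ are defined by: $s\vDash p$ iff $w\in V(p)$ for all $w\in s$; $s\mathrel{=\!\!\mid} p$ iff $w\notin V(p)$ for all $w\in s$; $s\vDash\mathrm{NE}$ iff $s\neq\emptyset$; $s\mathrel{=\!\!\mid}\mathrm{NE}$ iff $s=\emptyset$; $s\vDash\neg\phi$ iff $s\mathrel{=\!\!\mid}\phi$; $s\mathrel{=\!\!\mid}\neg\phi$ iff $s\vDash\phi$; $s\vDash\phi\wedge\psi$ iff $s\vDash\phi$ and $s\vDash\psi$; $s\mathrel{=\!\!\mid}\phi\wedge\psi$ iff $s=t\cup u$ with $t\mathrel{=\!\!\mid}\phi$, $u\mathrel{=\!\!\mid}\psi$; $s\vDash\phi\vee\psi$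 iff $s=t\cup u$ with $t\vDash\phi$, $u\vDash\psi$; $s\mathrel{=\!\!\mid}\phi\vee\psi$ iff $s\mathrel{=\!\!\mid}\phi$ and $s\mathrel{=\!\!\mid}\psi$; $s\vDash\phi\sqcup\psi$ iff $s\vDash\phi$ or $s\vDash\psi$; $s\mathrel{=\!\!\mid}\phi\sqcup\psi$ iff $s\mathrel{=\!\!\mid}\phi$ and $s\mathrel{=\!\!\mid}\psi$; $s\vDash\Diamond\phi$ iff for every $w\in s$ there is a nonempty $t\subseteq R[w]$ with $t\vDash\phi$; $s\mathrel{=\!\!\mid}\Diamond\phi$ iff $R[w]\mathrel{=\!\!\mid}\phi$ for all $w\in s$. Bisimulation (over fixed $\mathsf{X}$): $M,w\rightleftharpoons_0 M',w'$ iff $w,w'$ satisfy the same variables of $\mathsf{X}$; $w\rightleftharpoons_{k+1}w'$ iff $w\rightleftharpoons_0 w'$, each $v\in R[w]$ has some $v'\in R'[w']$ with $v\rightleftharpoons_k v'$, and each $v'\in R'[w']$ has some $v\in R[w]$ with $v\rightleftharpoons_k v'$. For states, $M,s\rightleftharpoons_k M',s'$ iff each $w\in s$ has some $w'\in s'$ with $w\rightleftharpoons_k w'$ and each $w'\in s'$ has some $w\in s$ with $w\rightleftharpoons_k w'$. A state property is a set of pointed state models $(M,s)$ over $\mathsf{X}$; a formula $\phi$ expresses $\|\phi\|=\{(M,s)\mid M,s\vDash\phi\}$, and $\|L\|=\{\|\phi\|\mid \phi\in L\}$. A property $\mathcal{P}$ is invariant under bounded bisimulation if for some $k\in\mathbb{N}$,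 $(M,s)\in\mathcal{P}$ and $M,s\rightleftharpoons_k M',s'$ imply $(M',s')\in\mathcal{P}$. -}

module Defs where

open import Level using (Level; 0ℓ) renaming (suc to lsuc)
open import Data.Nat using (ℕ; zero; suc)
open import Data.Fin using (Fin)
open import Data.Product using (Σ; ∃; _×_; _,_)
open import Data.Sum using (_⊎_)
open import Relation.Nullary using (¬_)
open import Function.Bundles using (_⇔_)

-- The fixed finite set X of propositional variables is Fin n.

record Model (n : ℕ) : Set₁ where
  field
    W  : Set
    w₀ : W              -- witness that W ≠ ∅
    R  : W → W → Set
    V  : Fin n → W → Set
open Model public

State : ∀ {n} → Model n → Set₁
State M = W M → Set

_≐_∪_ : ∀ {A : Set} → (A → Set) → (A → Set) → (A → Set) → Set
s ≐ t ∪ u = ∀ w → (s w → t w ⊎ u w) × (t w ⊎ u w → s w)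

data Form (n : ℕ) : Set where
  var  : Fin n → Form n
  ¬'_  : Form n → Form n
  _∧'_ : Form n → Form n → Form n
  _∨'_ : Form n → Form n → Form n
  ◇_   : Form n → Form n
  NE   : Form n
  _⊔_  : Form n → Form n → Form n

mutual
  _,_⊨_ : ∀ {n} (M : Model n) → State M → Form n → Set₁
  M , s ⊨ var p = Level.Lift (lsuc 0ℓ) (∀ w → s w → V M p w)
  M , s ⊨ (¬' φ) = M , s ⫤ φ
  M , s ⊨ (φ ∧' ψ) = (M , s ⊨ φ) × (M , s ⊨ ψ)
  M , s ⊨ (φ ∨' ψ) =
    Σ (State M) λ t → Σ (State M) λ u → Level.Lift (lsuc 0ℓ) (s ≐ t ∪ u) × (M , t ⊨ φ) × (M , u ⊨ ψ)
  M , s ⊨ (◇ φ) = ∀ w → s w →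
    Σ (State M) λ t → Level.Lift (lsuc 0ℓ) ((∀ v → t v → R M w v) × (∃ λ v → t v)) × (M , t ⊨ φ)
  M , s ⊨ NE = Level.Lift (lsuc 0ℓ) (∃ λ w → s w)
  M , s ⊨ (φ ⊔ ψ) = (M , s ⊨ φ) ⊎ (M , s ⊨ ψ)

  _,_⫤_ : ∀ {n} (M : Model n) → State M → Form n → Set₁
  M , s ⫤ var p = Level.Lift (lsuc 0ℓ) (∀ w → s w → ¬ V M p w)
  M , s ⫤ (¬' φ) = M , s ⊨ φ
  M , s ⫤ (φ ∧' ψ) =
    Σ (State M) λ t → Σ (State M) λ u → Level.Lift (lsuc 0ℓ) (s ≐ t ∪ u) × (M , t ⫤ φ) × (M , u ⫤ ψ)
  M , s ⫤ (φ ∨' ψ) = (M , s ⫤ φ) × (M , s ⫤ ψ)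
  M , s ⫤ (◇ φ) = ∀ w → s w → M , R M w ⫤ φ
  M , s ⫤ NE = Level.Lift (lsuc 0ℓ) (∀ w → ¬ s w)
  M , s ⫤ (φ ⊔ ψ) = (M , s ⫤ φ) × (M , s ⫤ ψ)

Bisim : ∀ {n} → ℕ → (M : Model n) → W M → (M' : Model n) → W M' → Set
Bisim zero    M w M' w' = ∀ p → V M p w ⇔ V M' p w'
Bisim (suc k) M w M' w' =
  Bisim zero M w M' w'
  × (∀ v → R M w v → ∃ λ v' → R M' w' v' × Bisim k M v M' v')
  × (∀ v' → R M' w' v' → ∃ λ v → R M w v × Bisim k M v M' v')

StBisim : ∀ {n} → ℕ → (M : Model n) → State M → (M' : Model n) → State M' → Set
StBisim k M s M' s' =
  (∀ w → s w → ∃ λ w' → s' w' × Bisim k M w M' w')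
  × (∀ w' → s' w' → ∃ λ w → s w × Bisim k M w M' w')

Property : ℕ → Set₂
Property n = (M : Model n) → State M → Set₁

⟦_⟧ : ∀ {n} → Form n → Property n
⟦ φ ⟧ M s = M , s ⊨ φ

BoundedInvariant : ∀ {n} → Property n → Set₁
BoundedInvariant {n} P = ∃ λ (k : ℕ) →
  ∀ (M : Model n) (s : State M) (M' : Model n) (s' : State M') →
    P M s → StBisim k M s M' s' → P M' s'

Expressible : ∀ {n} → Property n → Set₁
Expressible {n} P = ∃ λ (φ : Form n) → ∀ (M : Model n) (s : State M) → P M s ⇔ ⟦ φ ⟧ M s

{-# OPTIONS --safe #-}
module Submission where

-- A BSML⊔ formula of modal depth k is preserved by k-bisimilarity of states: for ∨ and the
-- anti-support of ∧ the splitting of a state is transported along the bisimulation, and for ◇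
-- the witnessing successor state likewise.
-- Conversely, over finitely many variables there are (classically) finitely many modal
-- characteristic formulas of depth k, and two worlds satisfying the same one are k-bisimilar.
-- Hence a state is determined up to k-bisimilarity by the set T of depth-k types it realizes,
-- which the flat formula ⋁_{χ ∈ T} (χ ∧ NE) expresses; a k-invariant property is the global
-- disjunction of these formulas over the sets T realized by some state of the property.

open import Defs
open import Level using (0ℓ; lift; lower) renaming (suc to lsuc)
open import Data.Nat using (ℕ; zero; suc; _≤_; s≤s) renaming (_⊔_ to _⊔ℕ_)
open import Data.Nat.Properties using (≤-refl; m⊔n≤o⇒m≤o; m⊔n≤o⇒n≤o)
open import Data.Fin using (Fin)
open import Data.Product using (Σ; ∃; ∃₂; _×_; _,_; proj₁; proj₂)
open import Data.Bool using (true; false)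
open import Data.Sum using (_⊎_; inj₁; inj₂; [_,_])
open import Data.Unit using (⊤; tt)
open import Data.Empty using (⊥; ⊥-elim)
open import Data.List using (List; []; _∷_; _++_; map; foldr; filter; cartesianProductWith; allFin)
open import Data.List.Relation.Unary.Any using (Any; here; there; toSum)
import Data.List.Relation.Unary.Any.Properties as Any
open import Data.List.Relation.Unary.All using (All; []; _∷_)
import Data.List.Relation.Unary.All as All
import Data.List.Relation.Unary.All.Properties as All
open import Data.List.Membership.Propositional using (_∈_; find; lose)
open import Data.List.Membership.Propositional.Properties
  using (∈-map⁺; ∈-map⁻; ∈-++⁺ˡ; ∈-++⁺ʳ; ∈-++⁻; ∈-filter⁺; ∈-filter⁻;
         ∈-cartesianProductWith⁺; ∈-cartesianProductWith⁻; ∈-allFin)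
open import Data.List.Relation.Binary.Subset.Propositional using (_⊆_)
open import Relation.Nullary using (¬_; Dec; yes; no; does)
open import Relation.Nullary.Decidable using (map′)
open import Relation.Unary using (Pred; Decidable)
open import Relation.Binary.PropositionalEquality using (refl)
open import Function using (_∘_)
open import Function.Bundles using (_⇔_; mk⇔; Equivalence)
open import Axiom.ExcludedMiddle using (ExcludedMiddle)

depth : ∀ {n} → Form n → ℕ
depth (var p)  = 0
depth (¬' φ)   = depth φ
depth (φ ∧' ψ) = depth φ ⊔ℕ depth ψ
depth (φ ∨' ψ) = depth φ ⊔ℕ depth ψ
depth (◇ φ)    = suc (depth φ)
depth NE       = 0
depth (φ ⊔ ψ)  = depth φ ⊔ℕ depth ψ

module _ {n : ℕ} where

  Bisim⇒Bisim₀ : ∀ k {M M' : Model n} {w w'} → Bisim k M w M' w' → Bisim zero M w M' w'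
  Bisim⇒Bisim₀ zero    b = b
  Bisim⇒Bisim₀ (suc k) b = proj₁ b

  Bisim⇒successorsBisim : ∀ {k} {M M' : Model n} {w w'} →
    Bisim (suc k) M w M' w' → StBisim k M (R M w) M' (R M' w')
  Bisim⇒successorsBisim (_ , forth , back) = forth , back

module _ {n : ℕ} {k : ℕ} {M M' : Model n} where

  bisimilarPart : State M → State M' → State M'
  bisimilarPart t s' w' = s' w' × ∃ λ w → t w × Bisim k M w M' w'

  StBisim-restrict : ∀ {s t : State M} {s' : State M'} → (∀ w → t w → s w) →
    StBisim k M s M' s' → StBisim k M t M' (bisimilarPart t s')
  StBisim-restrict t⊆s (forth , _) =
    (λ w tw → let w' , s'w' , b = forth w (t⊆s w tw) in w' , (s'w' , w , tw , b) , b) ,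
    (λ { w' (_ , w , tw , b) → w , tw , b })

  StBisim-split : ∀ {s t u : State M} {s' : State M'} → s ≐ t ∪ u → StBisim k M s M' s' →
    s' ≐ bisimilarPart t s' ∪ bisimilarPart u s'
    × StBisim k M t M' (bisimilarPart t s') × StBisim k M u M' (bisimilarPart u s')
  StBisim-split s≐t∪u s≈s'@(_ , back) =
    (λ w' → (λ s'w' → let w , sw , b = back w' s'w' in
                [ (λ tw → inj₁ (s'w' , w , tw , b)) , (λ uw → inj₂ (s'w' , w , uw , b)) ]
                (proj₁ (s≐t∪u w) sw)) ,
            [ proj₁ , proj₁ ]) ,
    StBisim-restrict (λ w → proj₂ (s≐t∪u w) ∘ inj₁) s≈s' ,
    StBisim-restrict (λ w → proj₂ (s≐t∪u w) ∘ inj₂) s≈s'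

  StBisim-◇ : ∀ {w w'} {t : State M} → Bisim (suc k) M w M' w' →
    (∀ v → t v → R M w v) → ∃ t →
    Σ (State M') λ t' → (∀ v' → t' v' → R M' w' v') × ∃ t' × StBisim k M t M' t'
  StBisim-◇ {w' = w'} {t} b t⊆Rw (v , tv) = t' , (λ _ → proj₁) , t'-nonempty , t≈t'
    where
    t' : State M'
    t' = bisimilarPart t (R M' w')
    t≈t' : StBisim k M t M' t'
    t≈t' = StBisim-restrict t⊆Rw (Bisim⇒successorsBisim b)
    t'-nonempty : ∃ t'
    t'-nonempty = let v' , t'v' , _ = proj₁ t≈t' v tv in v' , t'v'

module _ {n : ℕ} where

  mutual
    ⊨-invariant : (φ : Form n) {k : ℕ} → depth φ ≤ k →
      ∀ {M M' : Model n} {s s'} → StBisim k M s M' s' → M , s ⊨ φ → M' , s' ⊨ φ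
    ⊨-invariant (var p) {k} _ (_ , back) (lift f) =
      lift λ w' s'w' → let w , sw , b = back w' s'w' in Equivalence.to (Bisim⇒Bisim₀ k b p) (f w sw)
    ⊨-invariant (¬' φ) d s≈s' h = ⫤-invariant φ d s≈s' h
    ⊨-invariant (φ ∧' ψ) d s≈s' (hφ , hψ) =
      ⊨-invariant φ (m⊔n≤o⇒m≤o (depth φ) (depth ψ) d) s≈s' hφ ,
      ⊨-invariant ψ (m⊔n≤o⇒n≤o (depth φ) (depth ψ) d) s≈s' hψ
    ⊨-invariant (φ ∨' ψ) d s≈s' (_ , _ , lift s≐t∪u , hφ , hψ) =
      let s'≐t'∪u' , t≈t' , u≈u' = StBisim-split s≐t∪u s≈s' in
      _ , _ , lift s'≐t'∪u' ,
      ⊨-invariant φ (m⊔n≤o⇒m≤o (depth φ) (depth ψ) d) t≈t' hφ ,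
      ⊨-invariant ψ (m⊔n≤o⇒n≤o (depth φ) (depth ψ) d) u≈u' hψ
    ⊨-invariant (◇ φ) (s≤s d) (_ , back) h w' s'w' =
      let w , sw , b = back w' s'w' ; t , lift (t⊆Rw , t≠∅) , ht = h w sw
          t' , t'⊆Rw' , t'≠∅ , t≈t' = StBisim-◇ b t⊆Rw t≠∅
      in t' , lift (t'⊆Rw' , t'≠∅) , ⊨-invariant φ d t≈t' ht
    ⊨-invariant NE _ (forth , _) (lift (w , sw)) = let w' , s'w' , _ = forth w sw in lift (w' , s'w')
    ⊨-invariant (φ ⊔ ψ) d s≈s' (inj₁ h) = inj₁ (⊨-invariant φ (m⊔n≤o⇒m≤o (depth φ) (depth ψ) d) s≈s' h)
    ⊨-invariant (φ ⊔ ψ) d s≈s' (inj₂ h) = inj₂ (⊨-invariant ψ (m⊔n≤o⇒n≤o (depth φ) (depth ψ) d) s≈s' h)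

    ⫤-invariant : (φ : Form n) {k : ℕ} → depth φ ≤ k →
      ∀ {M M' : Model n} {s s'} → StBisim k M s M' s' → M , s ⫤ φ → M' , s' ⫤ φ
    ⫤-invariant (var p) {k} _ (_ , back) (lift f) =
      lift λ w' s'w' → let w , sw , b = back w' s'w' in f w sw ∘ Equivalence.from (Bisim⇒Bisim₀ k b p)
    ⫤-invariant (¬' φ) d s≈s' h = ⊨-invariant φ d s≈s' h
    ⫤-invariant (φ ∧' ψ) d s≈s' (_ , _ , lift s≐t∪u , hφ , hψ) =
      let s'≐t'∪u' , t≈t' , u≈u' = StBisim-split s≐t∪u s≈s' in
      _ , _ , lift s'≐t'∪u' ,
      ⫤-invariant φ (m⊔n≤o⇒m≤o (depth φ) (depth ψ) d) t≈t' hφ ,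
      ⫤-invariant ψ (m⊔n≤o⇒n≤o (depth φ) (depth ψ) d) u≈u' hψ
    ⫤-invariant (φ ∨' ψ) d s≈s' (hφ , hψ) =
      ⫤-invariant φ (m⊔n≤o⇒m≤o (depth φ) (depth ψ) d) s≈s' hφ ,
      ⫤-invariant ψ (m⊔n≤o⇒n≤o (depth φ) (depth ψ) d) s≈s' hψ
    ⫤-invariant (◇ φ) (s≤s d) (_ , back) h w' s'w' =
      let w , sw , b = back w' s'w' in ⫤-invariant φ d (Bisim⇒successorsBisim b) (h w sw)
    ⫤-invariant NE _ (_ , back) (lift f) = lift λ w' s'w' → let w , sw , _ = back w' s'w' in f w sw
    ⫤-invariant (φ ⊔ ψ) d s≈s' (hφ , hψ) =
      ⫤-invariant φ (m⊔n≤o⇒m≤o (depth φ) (depth ψ) d) s≈s' hφ ,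
      ⫤-invariant ψ (m⊔n≤o⇒n≤o (depth φ) (depth ψ) d) s≈s' hψ

  ⟦⟧-boundedInvariant : (φ : Form n) → BoundedInvariant ⟦ φ ⟧
  ⟦⟧-boundedInvariant φ = depth φ , λ M s M' s' h s≈s' → ⊨-invariant φ ≤-refl s≈s' h

sublists : ∀ {a} {A : Set a} → List A → List (List A)
sublists []       = [] ∷ []
sublists (x ∷ xs) = map (x ∷_) (sublists xs) ++ sublists xs

module _ {a} {A : Set a} where

  ∈-sublists⇒⊆ : ∀ {ys} (xs : List A) → ys ∈ sublists xs → ys ⊆ xs
  ∈-sublists⇒⊆ []       (here refl) ()
  ∈-sublists⇒⊆ (x ∷ xs) ys∈ with ∈-++⁻ (map (x ∷_) (sublists xs)) ys∈
  ... | inj₂ ys∈′ = there ∘ ∈-sublists⇒⊆ xs ys∈′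
  ... | inj₁ x∷zs∈ with ∈-map⁻ (x ∷_) x∷zs∈
  ...   | zs , zs∈ , refl = λ { (here refl) → here refl ; (there z∈) → there (∈-sublists⇒⊆ xs zs∈ z∈) }

  filter∈sublists : ∀ {p} {P : Pred A p} (P? : Decidable P) xs → filter P? xs ∈ sublists xs
  filter∈sublists P? []       = here refl
  filter∈sublists P? (x ∷ xs) with does (P? x)
  ... | true  = ∈-++⁺ˡ (∈-map⁺ (x ∷_) (filter∈sublists P? xs))
  ... | false = ∈-++⁺ʳ (map (x ∷_) (sublists xs)) (filter∈sublists P? xs)

data ModalForm (n : ℕ) : Set where
  pos neg   : Fin n → ModalForm n
  ⊤ᶠ ⊥ᶠ     : ModalForm n
  _∧ᶠ_ _∨ᶠ_ : ModalForm n → ModalForm n → ModalForm n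
  ◇ᶠ_ □ᶠ_   : ModalForm n → ModalForm n

infixr 6 _∧ᶠ_ _∨ᶠ_
infix 7 ◇ᶠ_ □ᶠ_

module _ {n : ℕ} where

  _,_⊩_ : (M : Model n) → W M → ModalForm n → Set
  M , w ⊩ pos p    = V M p w
  M , w ⊩ neg p    = ¬ V M p w
  M , w ⊩ ⊤ᶠ       = ⊤
  M , w ⊩ ⊥ᶠ       = ⊥
  M , w ⊩ (φ ∧ᶠ ψ) = M , w ⊩ φ × M , w ⊩ ψ
  M , w ⊩ (φ ∨ᶠ ψ) = M , w ⊩ φ ⊎ M , w ⊩ ψ
  M , w ⊩ (◇ᶠ φ)   = ∃ λ v → R M w v × M , v ⊩ φ
  M , w ⊩ (□ᶠ φ)   = ∀ v → R M w v → M , v ⊩ φ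

  ⋀ ⋁ : List (ModalForm n) → ModalForm n
  ⋀ = foldr _∧ᶠ_ ⊤ᶠ
  ⋁ = foldr _∨ᶠ_ ⊥ᶠ

  ⊩-⋀⁺ : ∀ {M w} φs → All (M , w ⊩_) φs → M , w ⊩ ⋀ φs
  ⊩-⋀⁺ []       []       = tt
  ⊩-⋀⁺ (φ ∷ φs) (h ∷ hs) = h , ⊩-⋀⁺ φs hs

  ⊩-⋀⁻ : ∀ {M w} φs → M , w ⊩ ⋀ φs → All (M , w ⊩_) φs
  ⊩-⋀⁻ []       tt       = []
  ⊩-⋀⁻ (φ ∷ φs) (h , hs) = h ∷ ⊩-⋀⁻ φs hs

  ⊩-⋁⁺ : ∀ {M w} {φs} → Any (M , w ⊩_) φs → M , w ⊩ ⋁ φs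
  ⊩-⋁⁺ (here h)  = inj₁ h
  ⊩-⋁⁺ (there h) = inj₂ (⊩-⋁⁺ h)

  ⊩-⋁⁻ : ∀ {M w} φs → M , w ⊩ ⋁ φs → Any (M , w ⊩_) φs
  ⊩-⋁⁻ (φ ∷ φs) (inj₁ h) = here h
  ⊩-⋁⁻ (φ ∷ φs) (inj₂ h) = there (⊩-⋁⁻ φs h)

  embed : ModalForm n → Form n
  embed (pos p)  = var p
  embed (neg p)  = ¬' var p
  embed ⊤ᶠ       = NE ⊔ (¬' NE)
  embed ⊥ᶠ       = ¬' NE
  embed (φ ∧ᶠ ψ) = embed φ ∧' embed ψ
  embed (φ ∨ᶠ ψ) = embed φ ∨' embed ψ
  embed (◇ᶠ φ)   = ◇ embed φ
  embed (□ᶠ φ)   = ¬' (◇ (¬' embed φ))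

  embed-flat⁺ : ∀ φ {M s} → M , s ⊨ embed φ → ∀ w → s w → M , w ⊩ φ
  embed-flat⁺ (pos p)  (lift h)  = h
  embed-flat⁺ (neg p)  (lift h)  = h
  embed-flat⁺ ⊤ᶠ       _ _ _     = tt
  embed-flat⁺ ⊥ᶠ       (lift h)  = h
  embed-flat⁺ (φ ∧ᶠ ψ) (hφ , hψ) w sw = embed-flat⁺ φ hφ w sw , embed-flat⁺ ψ hψ w sw
  embed-flat⁺ (φ ∨ᶠ ψ) (t , u , lift s≐t∪u , hφ , hψ) w sw =
    [ inj₁ ∘ embed-flat⁺ φ hφ w , inj₂ ∘ embed-flat⁺ ψ hψ w ] (proj₁ (s≐t∪u w) sw)
  embed-flat⁺ (◇ᶠ φ)   h w sw =
    let t , lift (t⊆Rw , v , tv) , ht = h w sw in v , t⊆Rw v tv , embed-flat⁺ φ ht v tv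
  embed-flat⁺ (□ᶠ φ)   h w sw = embed-flat⁺ φ (h w sw)

  literals : Fin n → List (ModalForm n)
  literals p = pos p ∷ neg p ∷ []

  literalTypes : List (Fin n) → List (ModalForm n)
  literalTypes []       = ⊤ᶠ ∷ []
  literalTypes (p ∷ ps) = cartesianProductWith _∧ᶠ_ (literals p) (literalTypes ps)

  typeOf : ModalForm n → List (ModalForm n) → ModalForm n
  typeOf ℓ S = ℓ ∧ᶠ (⋀ (map ◇ᶠ_ S) ∧ᶠ □ᶠ ⋁ S)

  types : ℕ → List (ModalForm n)
  types zero    = literalTypes (allFin n)
  types (suc k) = cartesianProductWith typeOf (types zero) (sublists (types k))

  literalTypes-agree : ∀ ps {M M' : Model n} {w w' χ} → χ ∈ literalTypes ps →
    M , w ⊩ χ → M' , w' ⊩ χ → All (λ p → V M p w ⇔ V M' p w') ps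
  literalTypes-agree []       _  _ _ = []
  literalTypes-agree (p ∷ ps) χ∈ h h'
    with ∈-cartesianProductWith⁻ _∧ᶠ_ (literals p) (literalTypes ps) χ∈
  ... | _ , _ , here refl , χ'∈ , refl =
    mk⇔ (λ _ → proj₁ h') (λ _ → proj₁ h) ∷ literalTypes-agree ps χ'∈ (proj₂ h) (proj₂ h')
  ... | _ , _ , there (here refl) , χ'∈ , refl =
    mk⇔ (⊥-elim ∘ proj₁ h) (⊥-elim ∘ proj₁ h') ∷ literalTypes-agree ps χ'∈ (proj₂ h) (proj₂ h')

  types-determine : ∀ k {M M' : Model n} {w w' χ} → χ ∈ types k →
    M , w ⊩ χ → M' , w' ⊩ χ → Bisim k M w M' w'
  types-determine zero χ∈ h h' p = All.lookup (literalTypes-agree (allFin n) χ∈ h h') (∈-allFin p)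
  types-determine (suc k) {M} {M'} {w} {w'} χ∈ h h'
    with ∈-cartesianProductWith⁻ typeOf (types zero) (sublists (types k)) χ∈
  ... | ℓ , S , ℓ∈ , S∈ , refl =
    types-determine zero ℓ∈ (proj₁ h) (proj₁ h') ,
    (λ v r → let v' , _ , r' , σ∈ , hv , hv' = match (proj₂ (proj₂ h)) (proj₁ (proj₂ h')) v r
             in v' , r' , types-determine k σ∈ hv hv') ,
    (λ v' r' → let v , _ , r , σ∈ , hv' , hv = match (proj₂ (proj₂ h')) (proj₁ (proj₂ h)) v' r'
               in v , r , types-determine k σ∈ hv hv')
    where
    match : ∀ {N N' : Model n} {u u'} → N , u ⊩ (□ᶠ ⋁ S) → N' , u' ⊩ ⋀ (map ◇ᶠ_ S) →
      ∀ v → R N u v → ∃₂ λ v' σ → R N' u' v' × σ ∈ types k × N , v ⊩ σ × N' , v' ⊩ σ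
    match □⋁S ⋀◇S v r =
      let σ , σ∈S , hv = find (⊩-⋁⁻ S (□⋁S v r))
          v' , r' , hv' = All.lookup (All.map⁻ (⊩-⋀⁻ (map ◇ᶠ_ S) ⋀◇S)) σ∈S
      in v' , σ , r' , ∈-sublists⇒⊆ (types k) S∈ σ∈S , hv , hv'

  Realizes : (M : Model n) → State M → List (ModalForm n) → Set
  Realizes M s T = (∀ w → s w → Any (M , w ⊩_) T) × All (λ χ → ∃ λ w → s w × M , w ⊩ χ) T

  Realizes⇒StBisim : ∀ {k T} {M M' : Model n} {s s'} → T ⊆ types k →
    Realizes M s T → Realizes M' s' T → StBisim k M s M' s'
  Realizes⇒StBisim {k} T⊆ (typed , realized) (typed' , realized') =
    (λ w sw → let χ , χ∈ , h = find (typed w sw) ; w' , s'w' , h' = All.lookup realized' χ∈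
              in w' , s'w' , types-determine k (T⊆ χ∈) h h') ,
    (λ w' s'w' → let χ , χ∈ , h' = find (typed' w' s'w') ; w , sw , h = All.lookup realized χ∈
                 in w , sw , types-determine k (T⊆ χ∈) h h')

  exactly : List (ModalForm n) → Form n
  exactly []      = ¬' NE
  exactly (χ ∷ T) = (embed χ ∧' NE) ∨' exactly T

  exactly⁺ : ∀ T {M s} → M , s ⊨ exactly T → Realizes M s T
  exactly⁺ []      (lift s=∅) = (λ w sw → ⊥-elim (s=∅ w sw)) , []
  exactly⁺ (χ ∷ T) (t , u , lift s≐t∪u , (hχ , lift (w , tw)) , hT) =
    let typed , realized = exactly⁺ T hT in
    (λ v sv → [ here ∘ embed-flat⁺ χ hχ v , there ∘ typed v ] (proj₁ (s≐t∪u v) sv)) ,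
    (w , proj₂ (s≐t∪u w) (inj₁ tw) , embed-flat⁺ χ hχ w tw) ∷
    All.map (λ (v , uv , h) → v , proj₂ (s≐t∪u v) (inj₂ uv) , h) realized

  ⨆ : List (Form n) → Form n
  ⨆ []       = NE ∧' (¬' NE)
  ⨆ (φ ∷ φs) = φ ⊔ ⨆ φs

  ⊨-⨆⁺ : ∀ {M s} {φs} → Any (M , s ⊨_) φs → M , s ⊨ ⨆ φs
  ⊨-⨆⁺ (here h)  = inj₁ h
  ⊨-⨆⁺ (there h) = inj₂ (⊨-⨆⁺ h)

  ⊨-⨆⁻ : ∀ {M s} φs → M , s ⊨ ⨆ φs → Any (M , s ⊨_) φs
  ⊨-⨆⁻ []       (lift (w , sw) , lift s=∅) = ⊥-elim (s=∅ w sw)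
  ⊨-⨆⁻ (φ ∷ φs) (inj₁ h) = here h
  ⊨-⨆⁻ (φ ∷ φs) (inj₂ h) = there (⊨-⨆⁻ φs h)

module Classical (lem : ExcludedMiddle (lsuc 0ℓ)) {n : ℕ} where

  decide : (A : Set) → Dec A
  decide A = map′ lower lift lem

  embed-flat⁻ : ∀ φ {M s} → (∀ w → s w → M , w ⊩ φ) → M , s ⊨ embed {n} φ
  embed-flat⁻ (pos p)  h = lift h
  embed-flat⁻ (neg p)  h = lift h
  embed-flat⁻ ⊤ᶠ {s = s} _ with decide (∃ s)
  ... | yes s≠∅ = inj₁ (lift s≠∅)
  ... | no  s=∅ = inj₂ (lift λ w sw → s=∅ (w , sw))
  embed-flat⁻ ⊥ᶠ       h = lift h
  embed-flat⁻ (φ ∧ᶠ ψ) h = embed-flat⁻ φ (λ w → proj₁ ∘ h w) , embed-flat⁻ ψ (λ w → proj₂ ∘ h w)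
  embed-flat⁻ (φ ∨ᶠ ψ) {M} {s} h =
    (λ w → s w × M , w ⊩ φ) , (λ w → s w × M , w ⊩ ψ) ,
    lift (λ w → (λ sw → [ inj₁ ∘ (sw ,_) , inj₂ ∘ (sw ,_) ] (h w sw)) , [ proj₁ , proj₁ ]) ,
    embed-flat⁻ φ (λ _ → proj₂) , embed-flat⁻ ψ (λ _ → proj₂)
  embed-flat⁻ (◇ᶠ φ) {M} h w sw =
    let v , r , hv = h w sw in
    (λ u → R M w u × M , u ⊩ φ) , lift ((λ _ → proj₁) , v , r , hv) , embed-flat⁻ φ (λ _ → proj₂)
  embed-flat⁻ (□ᶠ φ) h w sw = embed-flat⁻ φ (h w sw)

  exactly⁻ : ∀ T {M s} → Realizes M s T → M , s ⊨ exactly {n} T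
  exactly⁻ []      (typed , []) = lift λ w sw → Any.¬Any[] (typed w sw)
  exactly⁻ (χ ∷ T) {M} {s} (typed , (w , sw , h) ∷ realized) =
    (λ v → s v × M , v ⊩ χ) , (λ v → s v × Any (M , v ⊩_) T) ,
    lift (λ v → (λ sv → [ inj₁ ∘ (sv ,_) , inj₂ ∘ (sv ,_) ] (toSum (typed v sv))) , [ proj₁ , proj₁ ]) ,
    (embed-flat⁻ χ (λ _ → proj₂) , lift (w , sw , h)) ,
    exactly⁻ T ((λ _ → proj₂) ,
      All.tabulate λ τ∈ → let v , sv , hv = All.lookup realized τ∈ in v , (sv , lose τ∈ hv) , hv)

  literalTypes-cover : ∀ ps (M : Model n) w → ∃ λ χ → χ ∈ literalTypes ps × M , w ⊩ χ
  literalTypes-cover []       M w = ⊤ᶠ , here refl , tt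
  literalTypes-cover (p ∷ ps) M w with literalTypes-cover ps M w | decide (V M p w)
  ... | χ , χ∈ , h | yes v  = pos p ∧ᶠ χ , ∈-cartesianProductWith⁺ _∧ᶠ_ {xs = literals p} (here refl) χ∈ , v , h
  ... | χ , χ∈ , h | no  ¬v = neg p ∧ᶠ χ , ∈-cartesianProductWith⁺ _∧ᶠ_ {xs = literals p} (there (here refl)) χ∈ , ¬v , h

  types-cover : ∀ k (M : Model n) w → ∃ λ χ → χ ∈ types k × M , w ⊩ χ
  types-cover zero    M w = literalTypes-cover (allFin n) M w
  types-cover (suc k) M w =
    let ℓ , ℓ∈ , hℓ = types-cover zero M w in
    typeOf ℓ S , ∈-cartesianProductWith⁺ typeOf ℓ∈ (filter∈sublists ◇? (types k)) ,
    hℓ , ⊩-⋀⁺ (map ◇ᶠ_ S) (All.map⁺ (All.all-filter ◇? (types k))) , successors-typed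
    where
    ◇? : Decidable (λ σ → M , w ⊩ (◇ᶠ σ))
    ◇? σ = decide (M , w ⊩ (◇ᶠ σ))
    S : List (ModalForm n)
    S = filter ◇? (types k)
    successors-typed : ∀ v → R M w v → M , v ⊩ ⋁ S
    successors-typed v r =
      let σ , σ∈ , hv = types-cover k M v in ⊩-⋁⁺ (lose (∈-filter⁺ ◇? σ∈ (v , r , hv)) hv)

  realizedIn? : (M : Model n) (s : State M) → Decidable (λ χ → ∃ λ w → s w × M , w ⊩ χ)
  realizedIn? M s χ = decide (∃ λ w → s w × M , w ⊩ χ)

  realizedTypes : ℕ → (M : Model n) → State M → List (ModalForm n)
  realizedTypes k M s = filter (realizedIn? M s) (types k)

  Realizes-realizedTypes : ∀ k (M : Model n) s → Realizes M s (realizedTypes k M s)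
  Realizes-realizedTypes k M s =
    (λ w sw → let χ , χ∈ , h = types-cover k M w in lose (∈-filter⁺ (realizedIn? M s) χ∈ (w , sw , h)) h) ,
    All.all-filter (realizedIn? M s) (types k)

  module _ (P : Property n) (k : ℕ)
           (P-invariant : ∀ M s M' s' → P M s → StBisim k M s M' s' → P M' s') where

    RealizedBySomeP : List (ModalForm n) → Set₁
    RealizedBySomeP T = Σ (Model n) λ M → Σ (State M) λ s → P M s × Realizes M s T

    RealizedBySomeP? : Decidable RealizedBySomeP
    RealizedBySomeP? T = lem

    candidates : List (List (ModalForm n))
    candidates = filter RealizedBySomeP? (sublists (types k))

    characteristic : Form n
    characteristic = ⨆ (map exactly candidates)

    P⇒characteristic : ∀ M s → P M s → M , s ⊨ characteristic
    P⇒characteristic M s p =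
      ⊨-⨆⁺ (lose (∈-map⁺ exactly T∈candidates) (exactly⁻ (realizedTypes k M s) realizes))
      where
      realizes : Realizes M s (realizedTypes k M s)
      realizes = Realizes-realizedTypes k M s
      T∈candidates : realizedTypes k M s ∈ candidates
      T∈candidates = ∈-filter⁺ RealizedBySomeP? (filter∈sublists (realizedIn? M s) (types k)) (M , s , p , realizes)

    characteristic⇒P : ∀ M s → M , s ⊨ characteristic → P M s
    characteristic⇒P M s h =
      let T , T∈ , hT = find (Any.map⁻ (⊨-⨆⁻ (map exactly candidates) h))
          T∈sublists , M₀ , s₀ , p₀ , r₀ = ∈-filter⁻ RealizedBySomeP? T∈
      in P-invariant M₀ s₀ M s p₀ (Realizes⇒StBisim (∈-sublists⇒⊆ (types k) T∈sublists) r₀ (exactly⁺ T hT))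

  boundedInvariant⇒expressible : (P : Property n) → BoundedInvariant P → Expressible P
  boundedInvariant⇒expressible P (k , P-invariant) =
    characteristic P k P-invariant ,
    λ M s → mk⇔ (P⇒characteristic P k P-invariant M s) (characteristic⇒P P k P-invariant M s)

theorem3p15 : ExcludedMiddle (lsuc 0ℓ) → (n : ℕ) →
    ((φ : Form n) → BoundedInvariant ⟦ φ ⟧)
    × ((P : Property n) → BoundedInvariant P → Expressible P)
theorem3p15 lem n = ⟦⟧-boundedInvariant , Classical.boundedInvariant⇒expressible lem
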